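{- Let $M$ be a Boolean matrix of average degree at least $d$. Then $M$ contains a submatrix $N$ of average degree $d'\geq d/3$ such that every row and every column of $N$ contains at least $d'/2$ one-entries, and either $\|N\|_{\mathrm{row}}^2\leq 6d'$ or $\|N\|_{\mathrm{col}}^2\leq 6d'$.
   Context: A Boolean matrix has entries in $\{0,1\}$; a submatrix is obtained by selecting any subset of rows and columns. The average degree of an $m\times n$ Boolean matrix is $2|M|/(m+n)$ where $|M|$ is the number of one-entries (the average degree of the bipartite graph with bi-adjacency matrix $M$). $\|N\|_{\mathrm{row}}$ is the maximum Euclidean norm of a row of $N$ and $\|N\|_{\mathrm{col}}$ is the maximum Euclidean norm of a column of $N$ (for Boolean $N$, their squares are the maximum number of one-entries in a row, resp. column).
   Formalization: The threshold d on the average degree of M ranges over the rationals. -}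

module Defs where

open import Data.Bool using (Bool; true; false)
open import Data.Nat as ℕ using (ℕ; _+_; _*_; _⊔_; _<_; >-nonZero)
open import Data.Fin using (Fin)
open import Data.List using (List; map; foldr; allFin)
open import Data.Nat.ListAction using (sum)
open import Data.Integer using (+_)
open import Data.Rational using (ℚ; _/_)

Matrix : ℕ → ℕ → Set
Matrix m n = Fin m → Fin n → Bool

b2n : Bool → ℕ
b2n true  = 1
b2n false = 0

rowOnes : ∀ {m n} → Matrix m n → Fin m → ℕ
rowOnes {n = n} M i = sum (map (λ j → b2n (M i j)) (allFin n))

colOnes : ∀ {m n} → Matrix m n → Fin n → ℕ
colOnes {m = m} M j = sum (map (λ i → b2n (M i j)) (allFin m))

ones : ∀ {m n} → Matrix m n → ℕ
ones {m = m} M = sum (map (rowOnes M) (allFin m))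

-- ‖M‖²_row = maximum number of ones in a row; ‖M‖²_col likewise (0 if no rows/cols)
rowNormSq : ∀ {m n} → Matrix m n → ℕ
rowNormSq {m = m} M = foldr _⊔_ 0 (map (rowOnes M) (allFin m))

colNormSq : ∀ {m n} → Matrix m n → ℕ
colNormSq {n = n} M = foldr _⊔_ 0 (map (colOnes M) (allFin n))

avgDeg : ∀ {m n} → Matrix m n → 0 < m + n → ℚ
avgDeg {m} {n} M pos = (+ (2 * ones M) / (m + n)) {{>-nonZero pos}}

-- submatrix of M selecting rows ρ and columns γ (injectivity imposed separately)
sub : ∀ {m n p q} → Matrix m n → (Fin p → Fin m) → (Fin q → Fin n) → Matrix p q
sub M ρ γ i j = M (ρ i) (γ j)

-- Write e for the number of ones of a matrix and s for its number of rows plus columns, so that its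
-- average degree is d = 2e/s. Deleting a line (row or column) with fewer than e/s ones does not lower e/s,
-- so deleting such lines while there are any ("peeling") leaves a submatrix at least as dense in which
-- every line has at least half the average degree.
-- Transposing if necessary, let there be at least as many rows as columns, and call a row light if it has
-- at most 4e/s ones. If the light rows carry at least e/3 ones, they form a submatrix of at least a third
-- of the density; peeling it keeps its rows light, and 4e/s = 2d is at most 6d′ since d′ ≥ d/3.
-- Otherwise the heavy rows carry more than 2e/3 ones, and since each has more than 4e/s ones and there are
-- at most s/2 columns, the heavy rows form a strictly smaller and strictly denser submatrix: recurse on it.

module Submission where

open import Defs

-- A separate module keeps ℕ's _*_ and _≤_ out of the scope of the statement, which uses ℚ's.
module BalancedSubmatrix where

  open import Data.Nat using (ℕ; zero; suc; _+_; _*_; _⊔_; _≤_; _<_; _≤?_; _<?_; z≤n; s≤s; NonZero; >-nonZero)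
  open import Data.Nat.Properties hiding (suc-injective)
  open import Data.Nat.Tactic.RingSolver using (solve)
  import Data.Nat.ListAction as List
  open import Algebra.Properties.Semiring.Sum +-*-semiring
    using (sum; sum-syntax; sum-cong-≗; sum-replicate-zero; sum-remove; ∑-comm; *-distribʳ-sum)
  open import Algebra.Properties.CommutativeSemigroup +-commutativeSemigroup using (x∙yz≈y∙xz)
  open import Data.Fin using (Fin; zero; suc; punchIn)
  open import Data.Fin.Properties using (any?; punchIn-injective; lift-injective; suc-injective)
  open import Data.List using (List; _∷_; []; map; foldr; allFin; tabulate)
  open import Data.List.Properties using (map-tabulate)
  open import Data.List.Relation.Unary.All as All using (All)
  open import Data.List.Relation.Unary.All.Properties using (map⁺; tabulate⁺)
  open import Data.Product using (∃; _×_; _,_)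
  open import Data.Sum as Sum using (_⊎_; inj₁)
  open import Data.Integer as ℤ using (+≤+)
  open import Data.Integer.Properties using (pos-*)
  open import Data.Rational as ℚ using (_/_; ½; toℚᵘ)
  open import Data.Rational.Properties as ℚ using (toℚᵘ-fromℚᵘ; toℚᵘ-homo-*; toℚᵘ-cancel-≤; toℚᵘ-injective)
  open import Data.Rational.Unnormalised as ℚᵘ using (mkℚᵘ; *≤*)
  import Data.Rational.Unnormalised.Properties as ℚᵘ
  open import Function using (_∘_; id; _↣_; mk↣; Injection)
  open import Function.Construct.Composition using (_↣-∘_)
  open import Function.Construct.Identity using (↣-id)
  open import Level using (0ℓ)
  open import Relation.Binary.PropositionalEquality
  open import Relation.Nullary using (¬_; Dec; yes; no; contradiction)
  open import Relation.Unary using (Pred; Decidable)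

  private
    variable
      k m n p q : ℕ

  ∑-mono-≤ : {f g : Fin n → ℕ} → (∀ i → f i ≤ g i) → sum f ≤ sum g
  ∑-mono-≤ {zero}  f≤g = z≤n
  ∑-mono-≤ {suc n} f≤g = +-mono-≤ (f≤g zero) (∑-mono-≤ (f≤g ∘ suc))

  ∑-const : ∀ n c → ∑[ i < n ] c ≡ n * c
  ∑-const zero    c = refl
  ∑-const (suc n) c = cong (_+_ c) (∑-const n c)

  listSum-tabulate : (f : Fin n → ℕ) → List.sum (tabulate f) ≡ sum f
  listSum-tabulate {zero}  f = refl
  listSum-tabulate {suc n} f = cong (_+_ (f zero)) (listSum-tabulate (f ∘ suc))

  listSum-allFin : (f : Fin n → ℕ) → List.sum (map f (allFin n)) ≡ sum f
  listSum-allFin f = trans (cong List.sum (map-tabulate id f)) (listSum-tabulate f)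

  record Split (P : Pred (Fin n) 0ℓ) : Set where
    field
      #in #out : ℕ
      inside : Fin #in ↣ Fin n
      outside : Fin #out ↣ Fin n
      inside-P : ∀ i → P (Injection.to inside i)
      outside-¬P : ∀ i → ¬ P (Injection.to outside i)
      ∑-split : ∀ f → sum (f ∘ Injection.to inside) + sum (f ∘ Injection.to outside) ≡ sum f

    #in+#out≡n : #in + #out ≡ n
    #in+#out≡n = begin
      #in + #out                            ≡⟨ cong₂ _+_ (∑-one #in) (∑-one #out) ⟨
      ∑[ i < #in ] 1 + ∑[ i < #out ] 1      ≡⟨ ∑-split (λ _ → 1) ⟩
      ∑[ i < n ] 1                          ≡⟨ ∑-one n ⟩
      n                                     ∎
      where
      open ≡-Reasoning
      ∑-one : ∀ k → ∑[ i < k ] 1 ≡ k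
      ∑-one k = trans (∑-const k 1) (*-identityʳ k)

    #in≤n : #in ≤ n
    #in≤n = ≤-trans (m≤m+n #in #out) (≤-reflexive #in+#out≡n)

  private
    suc↣ : Fin n ↣ Fin (suc n)
    suc↣ = mk↣ suc-injective

    zero∷↣ : Fin k ↣ Fin n → Fin (suc k) ↣ Fin (suc n)
    zero∷↣ σ = mk↣ (lift-injective (Injection.to σ) (Injection.injective σ) 1)

  module _ {P : Pred (Fin (suc n)) 0ℓ} where

    Split-inside-zero : P zero → Split (P ∘ suc) → Split P
    Split-inside-zero P0 r = record
      { inside = zero∷↣ inside
      ; outside = suc↣ ↣-∘ outside
      ; inside-P = λ { zero → P0 ; (suc i) → inside-P i }
      ; outside-¬P = outside-¬P
      ; ∑-split = λ f → trans (+-assoc (f zero) _ _) (cong (_+_ (f zero)) (∑-split (f ∘ suc)))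
      }
      where open Split r

    Split-outside-zero : ¬ P zero → Split (P ∘ suc) → Split P
    Split-outside-zero ¬P0 r = record
      { inside = suc↣ ↣-∘ inside
      ; outside = zero∷↣ outside
      ; inside-P = inside-P
      ; outside-¬P = λ { zero → ¬P0 ; (suc i) → outside-¬P i }
      ; ∑-split = λ f → trans (x∙yz≈y∙xz (sum (f ∘ suc ∘ Injection.to inside)) (f zero) _)
                              (cong (_+_ (f zero)) (∑-split (f ∘ suc)))
      }
      where open Split r

  split : {P : Pred (Fin n) 0ℓ} → Decidable P → Split P
  split {zero} P? = record
    { inside = ↣-id _ ; outside = ↣-id _ ; inside-P = λ () ; outside-¬P = λ () ; ∑-split = λ _ → refl }
  split {suc n} P? with P? zero
  ... | yes P0 = Split-inside-zero P0 (split (P? ∘ suc))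
  ... | no ¬P0 = Split-outside-zero ¬P0 (split (P? ∘ suc))

  rowSum : Matrix m n → Fin m → ℕ
  rowSum {n = n} X i = ∑[ j < n ] b2n (X i j)

  colSum : Matrix m n → Fin n → ℕ
  colSum {m = m} X j = ∑[ i < m ] b2n (X i j)

  total : Matrix m n → ℕ
  total {m = m} X = ∑[ i < m ] rowSum X i

  transpose : Matrix m n → Matrix n m
  transpose X j i = X i j

  rowOnes≡rowSum : (X : Matrix m n) (i : Fin m) → rowOnes X i ≡ rowSum X i
  rowOnes≡rowSum X i = listSum-allFin (λ j → b2n (X i j))

  colOnes≡colSum : (X : Matrix m n) (j : Fin n) → colOnes X j ≡ colSum X j
  colOnes≡colSum X j = listSum-allFin (λ i → b2n (X i j))

  ones≡total : (X : Matrix m n) → ones X ≡ total X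
  ones≡total X = trans (listSum-allFin (rowOnes X)) (sum-cong-≗ (rowOnes≡rowSum X))

  total-transpose : (X : Matrix m n) → total (transpose X) ≡ total X
  total-transpose X = sym (∑-comm (λ i j → b2n (X i j)))

  total>0⇒m>0 : (X : Matrix m n) → 0 < total X → 0 < m
  total>0⇒m>0 {suc m} X _ = s≤s z≤n

  record Submatrix (m n : ℕ) : Set where
    constructor submatrix
    field
      {height width} : ℕ
      rows : Fin height ↣ Fin m
      cols : Fin width ↣ Fin n

    size : ℕ
    size = height + width

  open Submatrix

  restrict : Matrix m n → (S : Submatrix m n) → Matrix (height S) (width S)
  restrict X S = sub X (Injection.to (rows S)) (Injection.to (cols S))

  full : Submatrix m n
  full = submatrix (↣-id _) (↣-id _)

  _⊚_ : (S : Submatrix m n) → Submatrix (height S) (width S) → Submatrix m n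
  S ⊚ T = submatrix (rows S ↣-∘ rows T) (cols S ↣-∘ cols T)

  _ᵀ : Submatrix m n → Submatrix n m
  S ᵀ = submatrix (cols S) (rows S)

  onlyRows : Fin k ↣ Fin m → Submatrix m n
  onlyRows σ = submatrix σ (↣-id _)

  removeRow : Fin m → Submatrix m n
  removeRow {suc m} i = onlyRows (mk↣ (λ {j k} → punchIn-injective i j k))

  removeCol : Fin n → Submatrix m n
  removeCol j = removeRow j ᵀ

  ratio-trans : ∀ {e₁ e₂ e₃ s₁ s₂ s₃} c d → 0 < s₂ →
    e₁ * s₂ ≤ c * (e₂ * s₁) → e₂ * s₃ ≤ d * (e₃ * s₂) → e₁ * s₃ ≤ c * d * (e₃ * s₁)
  ratio-trans {e₁} {e₂} {e₃} {s₁} {s₂} {s₃} c d s₂>0 h₁ h₂ =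
    *-cancelʳ-≤ _ _ s₂ {{>-nonZero s₂>0}} (begin
      e₁ * s₃ * s₂             ≡⟨ solve (e₁ ∷ s₂ ∷ s₃ ∷ []) ⟩
      e₁ * s₂ * s₃             ≤⟨ *-monoˡ-≤ s₃ h₁ ⟩
      c * (e₂ * s₁) * s₃       ≡⟨ solve (c ∷ e₂ ∷ s₁ ∷ s₃ ∷ []) ⟩
      c * s₁ * (e₂ * s₃)       ≤⟨ *-monoʳ-≤ (c * s₁) h₂ ⟩
      c * s₁ * (d * (e₃ * s₂)) ≡⟨ solve (c ∷ d ∷ e₃ ∷ s₁ ∷ s₂ ∷ []) ⟩
      c * d * (e₃ * s₁) * s₂   ∎)
    where open ≤-Reasoning

  -- The average degree 2 · total / size of `restrict X S` is at least 1/c times that of X.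
  DenseIn : ℕ → (X : Matrix m n) → Submatrix m n → Set
  DenseIn {m} {n} c X S = total X * size S ≤ c * (total (restrict X S) * (m + n))

  DenseIn-⊚ : ∀ c d (X : Matrix m n) (S : Submatrix m n) (T : Submatrix (height S) (width S)) →
    0 < size S → DenseIn c X S → DenseIn d (restrict X S) T → DenseIn (c * d) X (S ⊚ T)
  DenseIn-⊚ c d X S T S≠∅ =
    ratio-trans {total X} {total (restrict X S)} {total (restrict X (S ⊚ T))} c d S≠∅

  DenseIn-transpose : ∀ c (X : Matrix m n) (S : Submatrix n m) → DenseIn c (transpose X) S → DenseIn c X (S ᵀ)
  DenseIn-transpose {m} {n} c X S =
    subst₂ (λ a b → a ≤ c * b)
      (cong₂ _*_ (total-transpose X) (+-comm (height S) (width S)))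
      (cong₂ _*_ (total-transpose (restrict X (S ᵀ))) (+-comm n m))

  MatrixProperty : Set₁
  MatrixProperty = ∀ {p q} → Matrix p q → Set

  record DenseSubmatrix (c : ℕ) (Q : MatrixProperty) (X : Matrix m n) : Set where
    constructor dense-submatrix
    field
      S : Submatrix m n
      nonempty : 0 < size S
      dense : DenseIn c X S
      property : Q (restrict X S)

  DenseSubmatrix-⊚ : ∀ c d {Q : MatrixProperty} (X : Matrix m n) (S : Submatrix m n) →
    0 < size S → DenseIn c X S → DenseSubmatrix d Q (restrict X S) → DenseSubmatrix (c * d) Q X
  DenseSubmatrix-⊚ c d X S S≠∅ S-dense (dense-submatrix T T≠∅ T-dense QT) =
    dense-submatrix (S ⊚ T) T≠∅ (DenseIn-⊚ c d X S T S≠∅ S-dense T-dense) QT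

  DenseSubmatrix-full : ∀ {c} {Q : MatrixProperty} (X : Matrix m n) → 0 < m + n → Q X →
    DenseSubmatrix (suc c) Q X
  DenseSubmatrix-full {c = c} X X≠∅ QX = dense-submatrix full X≠∅ (m≤n*m _ (suc c)) QX

  DenseSubmatrix-map : ∀ {c} {Q Q′ : MatrixProperty} (X : Matrix m n) →
    (∀ S → DenseIn c X S → Q (restrict X S) → Q′ (restrict X S)) →
    DenseSubmatrix c Q X → DenseSubmatrix c Q′ X
  DenseSubmatrix-map X f (dense-submatrix S S≠∅ S-dense QS) = dense-submatrix S S≠∅ S-dense (f S S-dense QS)

  DenseSubmatrix-transpose : ∀ {c} {Q : MatrixProperty} (X : Matrix m n) →
    DenseSubmatrix c Q (transpose X) → DenseSubmatrix c (λ N → Q (transpose N)) X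
  DenseSubmatrix-transpose {c = c} X (dense-submatrix S S≠∅ S-dense QS) =
    dense-submatrix (S ᵀ) (subst (0 <_) (+-comm (height S) (width S)) S≠∅) (DenseIn-transpose c X S S-dense) QS

  -- Line conditions are cross-multiplied by the size p + q: with d′ = 2 · total X / (p + q), MinDegree says
  -- that every line has at least d′/2 ones, and SparseRows that every row has at most 6d′.

  RowsAtMost ColsAtMost : ℕ → ℕ → MatrixProperty
  RowsAtMost a b X = ∀ i → rowSum X i * a ≤ b
  ColsAtMost a b X = ∀ j → colSum X j * a ≤ b

  MinDegree : MatrixProperty
  MinDegree {p} {q} X = (∀ i → total X ≤ rowSum X i * (p + q)) × (∀ j → total X ≤ colSum X j * (p + q))

  SparseRows SparseCols : MatrixProperty
  SparseRows {p} {q} X = RowsAtMost (p + q) (12 * total X) X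
  SparseCols {p} {q} X = ColsAtMost (p + q) (12 * total X) X

  Balanced : MatrixProperty
  Balanced X = MinDegree X × (SparseRows X ⊎ SparseCols X)

  Balanced-transpose : (X : Matrix m n) → Balanced (transpose X) → Balanced X
  Balanced-transpose {m} {n} X ((rows-min , cols-min) , sparse) =
    ((λ i → rescale-min (rowSum X i) (cols-min i)) , (λ j → rescale-min (colSum X j) (rows-min j))) ,
    Sum.map (λ cols i → rescale-max (rowSum X i) (cols i)) (λ rows j → rescale-max (colSum X j) (rows j))
            (Sum.swap sparse)
    where
    rescale-min : ∀ r → total (transpose X) ≤ r * (n + m) → total X ≤ r * (m + n)
    rescale-min r = subst₂ (λ e s → e ≤ r * s) (total-transpose X) (+-comm n m)
    rescale-max : ∀ r → r * (n + m) ≤ 12 * total (transpose X) → r * (m + n) ≤ 12 * total X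
    rescale-max r = subst₂ (λ s e → r * s ≤ 12 * e) (+-comm n m) (total-transpose X)

  -- Peeling off sparse lines

  drop-sparse-line : ∀ {r e s} → r * suc s < r + e → (r + e) * s ≤ e * suc s
  drop-sparse-line {r} {e} {s} sparse = begin
    (r + e) * s   ≡⟨ *-distribʳ-+ s r e ⟩
    r * s + e * s ≤⟨ +-monoˡ-≤ (e * s) (<⇒≤ rs<e) ⟩
    e + e * s     ≡⟨ *-suc e s ⟨
    e * suc s     ∎
    where
    open ≤-Reasoning
    rs<e : r * s < e
    rs<e = +-cancelˡ-< r _ _ (subst (_< r + e) (*-suc r s) sparse)

  sparse-line-leaves-ones : ∀ {r e s} → r * suc s < r + e → 0 < e
  sparse-line-leaves-ones {r} {e} {s} sparse =
    +-cancelˡ-< r 0 e (≤-<-trans (≤-trans (≤-reflexive (+-identityʳ r)) (m≤m*n r (suc s))) sparse)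

  record Shrinking (X : Matrix m n) (S : Submatrix m n) : Set where
    constructor shrinking
    field
      nonempty : 0 < size S
      smaller : size S < m + n
      dense : DenseIn 1 X S

  Shrinking-transpose : (X : Matrix m n) (S : Submatrix n m) → Shrinking (transpose X) S → Shrinking X (S ᵀ)
  Shrinking-transpose {m} {n} X S (shrinking S≠∅ smaller S-dense) =
    shrinking (subst (0 <_) (+-comm (height S) (width S)) S≠∅)
              (subst₂ _<_ (+-comm (height S) (width S)) (+-comm n m) smaller)
              (DenseIn-transpose 1 X S S-dense)

  dropRow : (X : Matrix m n) (i : Fin m) → rowSum X i * (m + n) < total X → Shrinking X (removeRow i)
  dropRow {suc m} {n} X i sparse =
    shrinking (≤-trans (total>0⇒m>0 N (sparse-line-leaves-ones sparse′)) (m≤m+n m n))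
              ≤-refl
              (≤-trans (≤-reflexive (cong (_* (m + n)) total≡))
                       (≤-trans (drop-sparse-line {rowSum X i} {total N} sparse′) (m≤n*m _ 1)))
    where
    N : Matrix m n
    N = restrict X (removeRow i)
    total≡ : total X ≡ rowSum X i + total N
    total≡ = sum-remove {i = i} (rowSum X)
    sparse′ : rowSum X i * suc (m + n) < rowSum X i + total N
    sparse′ = subst (rowSum X i * suc (m + n) <_) total≡ sparse

  dropCol : (X : Matrix m n) (j : Fin n) → colSum X j * (m + n) < total X → Shrinking X (removeCol j)
  dropCol {m} {n} X j sparse = Shrinking-transpose X (removeRow j) (dropRow (transpose X) j sparse′)
    where
    sparse′ : rowSum (transpose X) j * (n + m) < total (transpose X)
    sparse′ = subst₂ (λ s e → colSum X j * s < e) (+-comm m n) (sym (total-transpose X)) sparse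

  RowsAtMost-removeRow : ∀ {a b} (X : Matrix m n) (i : Fin m) →
    RowsAtMost a b X → RowsAtMost a b (restrict X (removeRow i))
  RowsAtMost-removeRow {suc m} X i bound = bound ∘ punchIn i

  rowSum-removeCol : (X : Matrix m (suc n)) (j : Fin (suc n)) (i : Fin m) →
    rowSum (restrict X (removeCol j)) i ≤ rowSum X i
  rowSum-removeCol X j i =
    ≤-trans (m≤n+m _ _) (≤-reflexive (sym (sum-remove {i = j} (λ j′ → b2n (X i j′)))))

  RowsAtMost-removeCol : ∀ {a b} (X : Matrix m n) (j : Fin n) →
    RowsAtMost a b X → RowsAtMost a b (restrict X (removeCol j))
  RowsAtMost-removeCol {n = suc n} {a = a} X j bound i =
    ≤-trans (*-monoˡ-≤ a (rowSum-removeCol X j i)) (bound i)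

  Peeled : ℕ → ℕ → MatrixProperty
  Peeled a b X = MinDegree X × RowsAtMost a b X

  peel-fuel : ∀ k {a b} (X : Matrix m n) → m + n ≤ k → 0 < m + n → RowsAtMost a b X →
    DenseSubmatrix 1 (Peeled a b) X
  peel-fuel zero X size≤0 X≠∅ _ = contradiction (≤-trans X≠∅ size≤0) λ ()
  peel-fuel {m} {n} (suc k) {a} {b} X size≤k X≠∅ bound =
    peel-step (any? (λ i → rowSum X i * (m + n) <? total X)) (any? (λ j → colSum X j * (m + n) <? total X))
    where
    continue : ∀ S → Shrinking X S → RowsAtMost a b (restrict X S) → DenseSubmatrix 1 (Peeled a b) X
    continue S (shrinking S≠∅ smaller S-dense) S-bound =
      DenseSubmatrix-⊚ 1 1 X S S≠∅ S-dense
        (peel-fuel k (restrict X S) (≤-pred (≤-trans smaller size≤k)) S≠∅ S-bound)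

    peel-step : Dec (∃ λ i → rowSum X i * (m + n) < total X) → Dec (∃ λ j → colSum X j * (m + n) < total X) →
      DenseSubmatrix 1 (Peeled a b) X
    peel-step (yes (i , sparse)) _ = continue (removeRow i) (dropRow X i sparse) (RowsAtMost-removeRow X i bound)
    peel-step (no _) (yes (j , sparse)) = continue (removeCol j) (dropCol X j sparse) (RowsAtMost-removeCol X j bound)
    peel-step (no dense-rows) (no dense-cols) =
      DenseSubmatrix-full X X≠∅
        (((λ i → ≮⇒≥ (dense-rows ∘ (i ,_))) , (λ j → ≮⇒≥ (dense-cols ∘ (j ,_)))) , bound)

  peel : ∀ {a b} (X : Matrix m n) → 0 < m + n → RowsAtMost a b X → DenseSubmatrix 1 (Peeled a b) X
  peel {m} {n} X = peel-fuel (m + n) X ≤-refl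

  -- Light and heavy rows

  light-part-dense : ∀ {e eL k p q} → e ≤ 3 * eL → k ≤ p → e * (k + q) ≤ 3 * (eL * (p + q))
  light-part-dense {e} {eL} {k} {p} {q} e≤3eL k≤p =
    ≤-trans (*-mono-≤ e≤3eL (+-monoˡ-≤ q k≤p)) (≤-reflexive (*-assoc 3 eL (p + q)))

  light-rows-sparse : ∀ {r e eN s sN} → 0 < s → r * s ≤ 4 * e → e * sN ≤ 3 * (eN * s) → r * sN ≤ 12 * eN
  light-rows-sparse {r} {e} {eN} {s} {sN} s>0 light dense = *-cancelʳ-≤ _ _ s {{>-nonZero s>0}} (begin
    r * sN * s         ≡⟨ solve (r ∷ s ∷ sN ∷ []) ⟩
    r * s * sN         ≤⟨ *-monoˡ-≤ sN light ⟩
    4 * e * sN         ≡⟨ *-assoc 4 e sN ⟩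
    4 * (e * sN)       ≤⟨ *-monoʳ-≤ 4 dense ⟩
    4 * (3 * (eN * s)) ≡⟨ solve (eN ∷ s ∷ []) ⟩
    12 * eN * s        ∎)
    where open ≤-Reasoning

  heavy-part-mass : ∀ {e eL eH} → eL + eH ≡ e → 3 * eL < e → 2 * e < 3 * eH
  heavy-part-mass {e} {eL} {eH} eL+eH≡e light-minority = +-cancelˡ-< e _ _ (begin-strict
    e + 2 * e       ≡⟨ solve (e ∷ []) ⟩
    3 * e           ≡⟨ cong (3 *_) eL+eH≡e ⟨
    3 * (eL + eH)   ≡⟨ *-distribˡ-+ 3 eL eH ⟩
    3 * eL + 3 * eH <⟨ +-monoˡ-< (3 * eH) light-minority ⟩
    e + 3 * eH      ∎)
    where open ≤-Reasoning

  heavy-part-denser : ∀ {e eH k q s} → 0 < s → 2 * e < 3 * eH → k * (4 * e) ≤ eH * s → 2 * q ≤ s →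
    e * (k + q) < eH * s
  heavy-part-denser {e} {eH} {k} {q} {s} s>0 heavy-majority heavy 2q≤s = *-cancelˡ-< 4 _ _ (begin-strict
    4 * (e * (k + q))             ≡⟨ solve (e ∷ k ∷ q ∷ []) ⟩
    k * (4 * e) + 2 * e * (2 * q) ≤⟨ +-mono-≤ heavy (*-monoʳ-≤ (2 * e) 2q≤s) ⟩
    eH * s + 2 * e * s            <⟨ +-monoʳ-< (eH * s) (*-monoˡ-< s {{>-nonZero s>0}} heavy-majority) ⟩
    eH * s + 3 * eH * s           ≡⟨ solve (eH ∷ s ∷ []) ⟩
    4 * (eH * s)                  ∎)
    where open ≤-Reasoning

  denser-part-smaller : ∀ {e eH s′ s} → eH ≤ e → e * s′ < eH * s → s′ < s
  denser-part-smaller {e} {eH} {s′} {s} eH≤e denser =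
    *-cancelˡ-< e s′ s (<-≤-trans denser (*-monoˡ-≤ s eH≤e))

  DenseBalancedBelow : ℕ → Set
  DenseBalancedBelow s = ∀ {p q} (Y : Matrix p q) → p + q < s → 0 < p + q → DenseSubmatrix 3 Balanced Y

  module RowSplit {p q} (X : Matrix p (suc q)) where

    private
      s : ℕ
      s = p + suc q

      s>0 : 0 < s
      s>0 = ≤-trans (s≤s z≤n) (m≤n+m (suc q) p)

    Light : Pred (Fin p) 0ℓ
    Light i = rowSum X i * s ≤ 4 * total X

    rowSplit : Split Light
    rowSplit = split (λ i → rowSum X i * s ≤? 4 * total X)

    open Split rowSplit

    light heavy : Submatrix p (suc q)
    light = onlyRows inside
    heavy = onlyRows outside

    light+heavy : total (restrict X light) + total (restrict X heavy) ≡ total X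
    light+heavy = ∑-split (rowSum X)

    light-case : total X ≤ 3 * total (restrict X light) → DenseSubmatrix 3 Balanced X
    light-case light-third =
      DenseSubmatrix-map X sparsify
        (DenseSubmatrix-⊚ 3 1 X light light≠∅ light-dense (peel (restrict X light) light≠∅ inside-P))
      where
      light≠∅ : 0 < #in + suc q
      light≠∅ = ≤-trans (s≤s z≤n) (m≤n+m (suc q) #in)
      light-dense : DenseIn 3 X light
      light-dense = light-part-dense {eL = total (restrict X light)} {q = suc q} light-third #in≤n
      sparsify : ∀ S → DenseIn 3 X S → Peeled s (4 * total X) (restrict X S) → Balanced (restrict X S)
      sparsify S S-dense (min-degree , light-rows) = min-degree , inj₁ λ i →
        light-rows-sparse {rowSum (restrict X S) i} {total X} {total (restrict X S)} s>0 (light-rows i) S-dense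

    heavy-case : DenseBalancedBelow s → suc q ≤ p → 3 * total (restrict X light) < total X →
      DenseSubmatrix 3 Balanced X
    heavy-case below q≤p light-minority =
      DenseSubmatrix-⊚ 1 3 X heavy heavy≠∅ (≤-trans (<⇒≤ heavy-denser) (m≤n*m _ 1))
        (below (restrict X heavy) heavy-smaller heavy≠∅)
      where
      eH : ℕ
      eH = total (restrict X heavy)
      heavy≠∅ : 0 < #out + suc q
      heavy≠∅ = ≤-trans (s≤s z≤n) (m≤n+m (suc q) #out)
      heavy-rows : #out * (4 * total X) ≤ eH * s
      heavy-rows = begin
        #out * (4 * total X)           ≡⟨ ∑-const #out _ ⟨
        ∑[ i < #out ] (4 * total X)    ≤⟨ ∑-mono-≤ (λ i → <⇒≤ (≰⇒> (outside-¬P i))) ⟩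
        ∑[ i < #out ] (heavyRow i * s) ≡⟨ *-distribʳ-sum s heavyRow ⟨
        eH * s                         ∎
        where
        open ≤-Reasoning
        heavyRow : Fin #out → ℕ
        heavyRow = rowSum X ∘ Injection.to outside
      2q≤s : 2 * suc q ≤ s
      2q≤s = ≤-trans (≤-reflexive (cong (_+_ (suc q)) (+-identityʳ (suc q)))) (+-monoˡ-≤ (suc q) q≤p)
      heavy-denser : total X * (#out + suc q) < eH * s
      heavy-denser = heavy-part-denser {total X} {eH} {#out} {suc q} s>0
        (heavy-part-mass {eL = total (restrict X light)} light+heavy light-minority) heavy-rows 2q≤s
      heavy-smaller : #out + suc q < s
      heavy-smaller =
        denser-part-smaller {total X} {eH} (≤-trans (m≤n+m eH _) (≤-reflexive light+heavy)) heavy-denser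

    light-or-heavy : DenseBalancedBelow s → suc q ≤ p → DenseSubmatrix 3 Balanced X
    light-or-heavy below q≤p with total X ≤? 3 * total (restrict X light)
    ... | yes light-third   = light-case light-third
    ... | no light-minority = heavy-case below q≤p (≰⇒> light-minority)

  dense-balanced-tall : DenseBalancedBelow (p + q) → (X : Matrix p q) → q ≤ p → 0 < p + q →
    DenseSubmatrix 3 Balanced X
  dense-balanced-tall {p} {zero} _ X _ X≠∅ =
    DenseSubmatrix-full X X≠∅ (((λ _ → ≤-reflexive (sum-replicate-zero p)) , λ ()) , inj₁ (λ _ → z≤n))
  dense-balanced-tall {q = suc q} below X q≤p _ = RowSplit.light-or-heavy X below q≤p

  dense-balanced-fuel : ∀ k (X : Matrix m n) → m + n ≤ k → 0 < m + n → DenseSubmatrix 3 Balanced X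
  dense-balanced-fuel zero X size≤0 X≠∅ = contradiction (≤-trans X≠∅ size≤0) λ ()
  dense-balanced-fuel {m} {n} (suc k) X size≤k X≠∅ = orient (n ≤? m)
    where
    below : ∀ {s} → s ≤ suc k → DenseBalancedBelow s
    below s≤k Y smaller = dense-balanced-fuel k Y (≤-pred (≤-trans smaller s≤k))

    orient : Dec (n ≤ m) → DenseSubmatrix 3 Balanced X
    orient (yes n≤m) = dense-balanced-tall (below size≤k) X n≤m X≠∅
    orient (no n≰m)  =
      DenseSubmatrix-map X (λ S _ → Balanced-transpose (restrict X S)) (DenseSubmatrix-transpose X
        (dense-balanced-tall (below (subst (_≤ suc k) (+-comm m n) size≤k)) (transpose X) (<⇒≤ (≰⇒> n≰m))
          (subst (0 <_) (+-comm m n) X≠∅)))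

  dense-balanced : (X : Matrix m n) → 0 < m + n → DenseSubmatrix 3 Balanced X
  dense-balanced {m} {n} X = dense-balanced-fuel (m + n) X ≤-refl

  -- Average degrees as rationals

  toℚᵘ-/ : ∀ a b .{{_ : NonZero b}} → toℚᵘ (ℤ.+ a / b) ℚᵘ.≃ ℤ.+ a ℚᵘ./ b
  toℚᵘ-/ a (suc b) = toℚᵘ-fromℚᵘ (mkℚᵘ (ℤ.+ a) b)

  /≤/ : ∀ a b c d .{{_ : NonZero b}} .{{_ : NonZero d}} → a * d ≤ c * b → ℤ.+ a / b ℚ.≤ ℤ.+ c / d
  /≤/ a (suc b) c (suc d) ad≤cb = toℚᵘ-cancel-≤
    (ℚᵘ.≤-respˡ-≃ (ℚᵘ.≃-sym (toℚᵘ-/ a (suc b))) (ℚᵘ.≤-respʳ-≃ (ℚᵘ.≃-sym (toℚᵘ-/ c (suc d)))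
      (*≤* (subst₂ ℤ._≤_ (pos-* a (suc d)) (pos-* c (suc b)) (+≤+ ad≤cb)))))

  /*/≡/ : ∀ a b c d .{{_ : NonZero b}} .{{_ : NonZero d}} →
    (ℤ.+ a / b) ℚ.* (ℤ.+ c / d) ≡ (ℤ.+ (a * c) / (b * d)) {{m*n≢0 b d}}
  /*/≡/ a (suc b) c (suc d) = toℚᵘ-injective (begin
    toℚᵘ ((ℤ.+ a / suc b) ℚ.* (ℤ.+ c / suc d))     ≈⟨ toℚᵘ-homo-* (ℤ.+ a / suc b) (ℤ.+ c / suc d) ⟩
    toℚᵘ (ℤ.+ a / suc b) ℚᵘ.* toℚᵘ (ℤ.+ c / suc d) ≈⟨ ℚᵘ.*-cong (toℚᵘ-/ a (suc b)) (toℚᵘ-/ c (suc d)) ⟩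
    (ℤ.+ a ℤ.* ℤ.+ c) ℚᵘ./ (suc b * suc d)          ≡⟨ cong (ℚᵘ._/ (suc b * suc d)) (pos-* a c) ⟨
    ℤ.+ (a * c) ℚᵘ./ (suc b * suc d)                ≈⟨ toℚᵘ-/ (a * c) (suc b * suc d) ⟨
    toℚᵘ (ℤ.+ (a * c) / (suc b * suc d))            ∎)
    where open ℚᵘ.≃-Reasoning

  ⅓*avg≤avg : ∀ e s eN sN .{{_ : NonZero s}} .{{_ : NonZero sN}} → e * sN ≤ 3 * (eN * s) →
    ℤ.+ 1 / 3 ℚ.* (ℤ.+ (2 * e) / s) ℚ.≤ ℤ.+ (2 * eN) / sN
  ⅓*avg≤avg e s eN sN dense =
    ℚ.≤-trans (ℚ.≤-reflexive (/*/≡/ 1 3 (2 * e) s))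
      (/≤/ (1 * (2 * e)) (3 * s) (2 * eN) sN {{m*n≢0 3 s}} (begin
      1 * (2 * e) * sN   ≡⟨ solve (e ∷ sN ∷ []) ⟩
      2 * (e * sN)       ≤⟨ *-monoʳ-≤ 2 dense ⟩
      2 * (3 * (eN * s)) ≡⟨ solve (eN ∷ s ∷ []) ⟩
      2 * eN * (3 * s)   ∎))
    where open ≤-Reasoning

  ½*avg≤ : ∀ e s r .{{_ : NonZero s}} → e ≤ r * s → ½ ℚ.* (ℤ.+ (2 * e) / s) ℚ.≤ ℤ.+ r / 1
  ½*avg≤ e s r e≤rs =
    ℚ.≤-trans (ℚ.≤-reflexive (/*/≡/ 1 2 (2 * e) s)) (/≤/ (1 * (2 * e)) (2 * s) r 1 {{m*n≢0 2 s}} (begin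
      1 * (2 * e) * 1 ≡⟨ solve (e ∷ []) ⟩
      2 * e           ≤⟨ *-monoʳ-≤ 2 e≤rs ⟩
      2 * (r * s)     ≡⟨ solve (r ∷ s ∷ []) ⟩
      r * (2 * s)     ∎))
    where open ≤-Reasoning

  ≤6*avg : ∀ e s r .{{_ : NonZero s}} → r * s ≤ 12 * e → ℤ.+ r / 1 ℚ.≤ ℤ.+ 6 / 1 ℚ.* (ℤ.+ (2 * e) / s)
  ≤6*avg e s r rs≤12e =
    ℚ.≤-trans (/≤/ r 1 (6 * (2 * e)) (1 * s) {{_}} {{m*n≢0 1 s}} (begin
      r * (1 * s)     ≡⟨ solve (r ∷ s ∷ []) ⟩
      r * s           ≤⟨ rs≤12e ⟩
      12 * e          ≡⟨ solve (e ∷ []) ⟩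
      6 * (2 * e) * 1 ∎)) (ℚ.≤-reflexive (sym (/*/≡/ 6 1 (2 * e) s)))
    where open ≤-Reasoning

  foldr-⊔-*-≤ : ∀ {c b} (xs : List ℕ) → All (λ x → x * c ≤ b) xs → foldr _⊔_ 0 xs * c ≤ b
  foldr-⊔-*-≤     []       All.[]           = z≤n
  foldr-⊔-*-≤ {c} (x ∷ xs) (x≤b All.∷ xs≤b) =
    ≤-trans (≤-reflexive (*-distribʳ-⊔ c x _)) (⊔-lub x≤b (foldr-⊔-*-≤ xs xs≤b))

  ⅓*avgDeg≤avgDeg : (M : Matrix m n) (S : Submatrix m n) (M≠∅ : 0 < m + n) (S≠∅ : 0 < size S) → DenseIn 3 M S →
    ℤ.+ 1 / 3 ℚ.* avgDeg M M≠∅ ℚ.≤ avgDeg (restrict M S) S≠∅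
  ⅓*avgDeg≤avgDeg {m} {n} M S M≠∅ S≠∅ dense =
    ⅓*avg≤avg (ones M) (m + n) (ones (restrict M S)) (size S) {{>-nonZero M≠∅}} {{>-nonZero S≠∅}}
      (subst₂ (λ e eN → e * size S ≤ 3 * (eN * (m + n)))
        (sym (ones≡total M)) (sym (ones≡total (restrict M S))) dense)

  ½*avgDeg≤rowOnes : (N : Matrix p q) (N≠∅ : 0 < p + q) → MinDegree N →
    ∀ i → ½ ℚ.* avgDeg N N≠∅ ℚ.≤ ℤ.+ rowOnes N i / 1
  ½*avgDeg≤rowOnes {p} {q} N N≠∅ (rows-min , _) i =
    ½*avg≤ (ones N) (p + q) (rowOnes N i) {{>-nonZero N≠∅}}
      (subst₂ (λ e r → e ≤ r * (p + q)) (sym (ones≡total N)) (sym (rowOnes≡rowSum N i)) (rows-min i))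

  ½*avgDeg≤colOnes : (N : Matrix p q) (N≠∅ : 0 < p + q) → MinDegree N →
    ∀ j → ½ ℚ.* avgDeg N N≠∅ ℚ.≤ ℤ.+ colOnes N j / 1
  ½*avgDeg≤colOnes {p} {q} N N≠∅ (_ , cols-min) j =
    ½*avg≤ (ones N) (p + q) (colOnes N j) {{>-nonZero N≠∅}}
      (subst₂ (λ e r → e ≤ r * (p + q)) (sym (ones≡total N)) (sym (colOnes≡colSum N j)) (cols-min j))

  maxLine≤6*avgDeg : (N : Matrix p q) (N≠∅ : 0 < p + q) (line : Fin k → ℕ) →
    (∀ i → line i * (p + q) ≤ 12 * total N) →
    ℤ.+ foldr _⊔_ 0 (map line (allFin k)) / 1 ℚ.≤ ℤ.+ 6 / 1 ℚ.* avgDeg N N≠∅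
  maxLine≤6*avgDeg {p} {q} {k} N N≠∅ line bound =
    ≤6*avg (ones N) (p + q) max {{>-nonZero N≠∅}}
      (subst (λ e → max * (p + q) ≤ 12 * e) (sym (ones≡total N))
        (foldr-⊔-*-≤ (map line (allFin k)) (map⁺ (tabulate⁺ bound))))
    where
    max : ℕ
    max = foldr _⊔_ 0 (map line (allFin k))

  normSq≤6*avgDeg : (N : Matrix p q) (N≠∅ : 0 < p + q) → SparseRows N ⊎ SparseCols N →
    ℤ.+ rowNormSq N / 1 ℚ.≤ ℤ.+ 6 / 1 ℚ.* avgDeg N N≠∅
      ⊎ ℤ.+ colNormSq N / 1 ℚ.≤ ℤ.+ 6 / 1 ℚ.* avgDeg N N≠∅
  normSq≤6*avgDeg {p} {q} N N≠∅ = Sum.map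
    (λ sparse → maxLine≤6*avgDeg N N≠∅ (rowOnes N) λ i →
      subst (λ r → r * (p + q) ≤ 12 * total N) (sym (rowOnes≡rowSum N i)) (sparse i))
    (λ sparse → maxLine≤6*avgDeg N N≠∅ (colOnes N) λ j →
      subst (λ r → r * (p + q) ≤ 12 * total N) (sym (colOnes≡colSum N j)) (sparse j))

open import Data.Nat using (ℕ; _+_; _<_)
open import Data.Fin using (Fin)
open import Data.Product using (Σ; _×_; _,_; proj₁; proj₂)
open import Data.Sum using (_⊎_)
open import Data.Integer using (+_)
open import Data.Rational using (ℚ; _/_; _*_; _≤_; ½)
open import Data.Rational.Properties using (≤-trans; *-monoˡ-≤-nonNeg)
open import Function using (Injection)
open import Function.Definitions using (Injective)
open import Relation.Binary.PropositionalEquality using (_≡_)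
open BalancedSubmatrix
  using (Submatrix; restrict; DenseSubmatrix; dense-balanced
        ; ⅓*avgDeg≤avgDeg; ½*avgDeg≤rowOnes; ½*avgDeg≤colOnes; normSq≤6*avgDeg)

lemma7p1 : ∀ {m n} (M : Matrix m n) (pos : 0 < m + n) (d : ℚ) → d ≤ avgDeg M pos →
    Σ ℕ λ p → Σ ℕ λ q → Σ (Fin p → Fin m) λ ρ → Σ (Fin q → Fin n) λ γ →
    Injective _≡_ _≡_ ρ × Injective _≡_ _≡_ γ ×
    Σ (0 < p + q) λ pos′ →
      ((+ 1 / 3) * d ≤ avgDeg (sub M ρ γ) pos′) ×
      (∀ i → ½ * avgDeg (sub M ρ γ) pos′ ≤ (+ rowOnes (sub M ρ γ) i / 1)) ×
      (∀ j → ½ * avgDeg (sub M ρ γ) pos′ ≤ (+ colOnes (sub M ρ γ) j / 1)) ×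
      ((+ rowNormSq (sub M ρ γ) / 1) ≤ (+ 6 / 1) * avgDeg (sub M ρ γ) pos′
        ⊎ (+ colNormSq (sub M ρ γ) / 1) ≤ (+ 6 / 1) * avgDeg (sub M ρ γ) pos′)
lemma7p1 M pos d d≤avgDeg =
  height , width , to rows , to cols , injective rows , injective cols , nonempty ,
  ≤-trans (*-monoˡ-≤-nonNeg (+ 1 / 3) d≤avgDeg) (⅓*avgDeg≤avgDeg M S pos nonempty dense) ,
  ½*avgDeg≤rowOnes N nonempty (proj₁ property) ,
  ½*avgDeg≤colOnes N nonempty (proj₁ property) ,
  normSq≤6*avgDeg N nonempty (proj₂ property)
  where
  open DenseSubmatrix (dense-balanced M pos)
  open Submatrix S
  open Injection
  N : Matrix height width
  N = restrict M S
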